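{- Let $\Gamma\subseteq\mathrm{For}(\mathcal{L})$ be consistent and let $E(\Gamma):=\{\Gamma':\Gamma\subseteq\Gamma'\subseteq\mathrm{For}(\mathcal{L})\text{ and }\Gamma'\text{ is consistent}\}$, ordered by inclusion. Then $\Delta$ is a maximal member of $E(\Gamma)$ if and only if for all formulae $\varphi,\psi$: (i) $\Gamma\subseteq\Delta$ and $\Delta$ is consistent; (ii) if $\Delta\vdash_Q\varphi\mathbin{\dot{ - }}2^{ -n}$ for all $n<\omega$ then $\varphi\in\Delta$; (iii) $\varphi\mathbin{\dot{ - }}\psi\in\Delta$ or $\psi\mathbin{\dot{ - }}\varphi\in\Delta$.
   Context: $\mathcal{L}$ is a continuous signature: a nonempty set $\mathcal{R}$ of relation symbols, a set $\mathcal{F}$ of function symbols disjoint from $\mathcal{R}$, arities $n_s<\omega$, and functions $\delta_{s,i}:(0,1]\to(0,1]$ for $i<n_s$; possibly with a distinguished binary relation symbol $d$ (metric). Formulae: $Pt_0\cdots t_{n_P-1}$, $\varphi\mathbin{\dot{ - }}\psi$, $\neg\varphi$, $\tfrac12\varphi$, $\sup_x\varphi$. Abbreviations: $\varphi\wedge\psi:=\varphi\mathbin{\dot{ - }}(\varphi\mathbin{\dot{ - }}\psi)$, $1:=\neg(\varphi\mathbin{\dot{ - }}\varphi)$, $2^{ -n}:=\tfrac12\cdots\tfrac12 1$ ($n$ times), dyadic rationals $\mathbb{D}$ as formulas built from $1$ by $\neg,\mathbin{\dot{ - }},\tfrac12$. Proof system. Axioms: all generalizations $\sup_{x_1}\cdots\sup_{x_n}\chi$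 ($n\ge0$) of instances of (A1) $(\varphi\mathbin{\dot{ - }}\psi)\mathbin{\dot{ - }}\varphi$; (A2) $((\chi\mathbin{\dot{ - }}\varphi)\mathbin{\dot{ - }}(\chi\mathbin{\dot{ - }}\psi))\mathbin{\dot{ - }}(\psi\mathbin{\dot{ - }}\varphi)$; (A3) $(\varphi\mathbin{\dot{ - }}(\varphi\mathbin{\dot{ - }}\psi))\mathbin{\dot{ - }}(\psi\mathbin{\dot{ - }}(\psi\mathbin{\dot{ - }}\varphi))$; (A4) $(\varphi\mathbin{\dot{ - }}\psi)\mathbin{\dot{ - }}(\neg\psi\mathbin{\dot{ - }}\neg\varphi)$; (A5) $\tfrac12\varphi\mathbin{\dot{ - }}(\varphi\mathbin{\dot{ - }}\tfrac12\varphi)$; (A6) $(\varphi\mathbin{\dot{ - }}\tfrac12\varphi)\mathbin{\dot{ - }}\tfrac12\varphi$; (A7) $(\sup_x\psi\mathbin{\dot{ - }}\sup_x\varphi)\mathbin{\dot{ - }}\sup_x(\psi\mathbin{\dot{ - }}\varphi)$; (A8) $\varphi[t/x]\mathbin{\dot{ - }}\sup_x\varphi$ (free substitution, no variable of $t$ becoming bound); (A9) $\sup_x\varphi\mathbin{\dot{ - }}\varphi$ ($x$ not free in $\varphi$); with a metric also (A10) $dxx$; (A11) $dxy\mathbin{\dot{ - }}dyx$; (A12) $(dxz\mathbin{\dot{ - }}dxy)\mathbin{\dot{ - }}dyz$; (A13) $(q\mathbin{\dot{ - }}dzw)\wedge(d\,f\bar xz\bar y\,f\bar xw\bar y\mathbin{\dot{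 - }}r)$ for $f\in\mathcal{F}$, $|\bar x|=i<n_f$, $\epsilon\in(0,1]$, $r,q\in\mathbb{D}$, $r>\epsilon$, $q<\delta_{f,i}(\epsilon)$; (A14) $(q\mathbin{\dot{ - }}dzw)\wedge((P\bar xz\bar y\mathbin{\dot{ - }}P\bar xw\bar y)\mathbin{\dot{ - }}r)$ analogously for $P\in\mathcal{R}$. Sole rule: modus ponens (from $\varphi$ and $\psi\mathbin{\dot{ - }}\varphi$ infer $\psi$). $\Gamma\vdash_Q\varphi$ iff $\varphi$ has a finite derivation from axioms and members of $\Gamma$. $\Gamma$ is inconsistent if it proves every formula, consistent otherwise. -}

module Defs where

open import Level using (0ℓ)
open import Data.Nat using (ℕ; _≟_)
open import Data.Fin using (Fin)
open import Data.Vec using (Vec; []; _∷_; map; replicate; _[_]≔_)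
open import Data.Vec.Relation.Unary.Any using (Any)
open import Data.Maybe using (Maybe; just)
open import Data.Product using (Σ; _×_; _,_)
open import Data.Sum using (_⊎_)
open import Data.Unit using (⊤)
open import Data.Rational using (ℚ; 1ℚ; 0ℚ; ½; _-_; _*_; _⊔_)
open import Relation.Nullary using (¬_; yes; no)
open import Relation.Binary.PropositionalEquality using (_≡_; _≢_; subst; sym)

record Signature : Set₁ where
  field
    Rel  : Set
    Fun  : Set                     -- function symbols 𝓕 (disjoint from 𝓡: separate types)
    arR  : Rel → ℕ
    arF  : Fun → ℕ
    R₀   : Rel                     -- witness that 𝓡 is nonempty
    -- the optional distinguished binary (metric) relation symbol d
    metric : Maybe (Σ Rel λ d → arR d ≡ 2)
    δF : (f : Fun) → Fin (arF f) → ℚ → ℚ → Set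
    δR : (P : Rel) → Fin (arR P) → ℚ → ℚ → Set

-- Closed dyadic-rational expressions: formulas built from 1 by ¬, ∸, ½.
data Dy : Set where
  one    : Dy
  dneg   : Dy → Dy
  dminus : Dy → Dy → Dy
  dhalf  : Dy → Dy

val : Dy → ℚ
val one          = 1ℚ
val (dneg a)     = 1ℚ - val a
val (dminus a b) = (val a - val b) ⊔ 0ℚ
val (dhalf a)    = ½ * val a

module Syntax (L : Signature) where
  open Signature L

  data Term : Set where
    var : ℕ → Term
    app : (f : Fun) → Vec Term (arF f) → Term

  data _occursIn_ (x : ℕ) : Term → Set where
    here  : x occursIn var x
    inApp : ∀ {f ts} → Any (x occursIn_) ts → x occursIn app f ts

  mutual
    substT : Term → ℕ → Term → Term
    substT (var y) x s with y ≟ x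
    ... | yes _ = s
    ... | no  _ = var y
    substT (app f ts) x s = app f (substTs ts x s)

    substTs : ∀ {n} → Vec Term n → ℕ → Term → Vec Term n
    substTs []       x s = []
    substTs (t ∷ ts) x s = substT t x s ∷ substTs ts x s

  infixl 6 _∸̇_

  data Formula : Set where
    rel  : (P : Rel) → Vec Term (arR P) → Formula
    _∸̇_  : Formula → Formula → Formula
    ¬̇_   : Formula → Formula
    ½̇_   : Formula → Formula
    sup  : ℕ → Formula → Formula

  data FreeIn (x : ℕ) : Formula → Set where
    fRel : ∀ {P ts} → Any (x occursIn_) ts → FreeIn x (rel P ts)
    fL   : ∀ {φ ψ} → FreeIn x φ → FreeIn x (φ ∸̇ ψ)
    fR   : ∀ {φ ψ} → FreeIn x ψ → FreeIn x (φ ∸̇ ψ)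
    fNeg : ∀ {φ} → FreeIn x φ → FreeIn x (¬̇ φ)
    fHalf : ∀ {φ} → FreeIn x φ → FreeIn x (½̇ φ)
    fSup : ∀ {y φ} → y ≢ x → FreeIn x φ → FreeIn x (sup y φ)

  _[_/_] : Formula → Term → ℕ → Formula
  rel P ts [ t / x ] = rel P (substTs ts x t)
  (φ ∸̇ ψ)  [ t / x ] = (φ [ t / x ]) ∸̇ (ψ [ t / x ])
  (¬̇ φ)    [ t / x ] = ¬̇ (φ [ t / x ])
  (½̇ φ)    [ t / x ] = ½̇ (φ [ t / x ])
  sup y φ  [ t / x ] with y ≟ x
  ... | yes _ = sup y φ
  ... | no  _ = sup y (φ [ t / x ])

  FreeFor : Term → ℕ → Formula → Set
  FreeFor t x (rel P ts) = ⊤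
  FreeFor t x (φ ∸̇ ψ)   = FreeFor t x φ × FreeFor t x ψ
  FreeFor t x (¬̇ φ)     = FreeFor t x φ
  FreeFor t x (½̇ φ)     = FreeFor t x φ
  FreeFor t x (sup y φ) = (¬ FreeIn x (sup y φ)) ⊎ ((¬ y occursIn t) × FreeFor t x φ)

  _∧̇_ : Formula → Formula → Formula
  φ ∧̇ ψ = φ ∸̇ (φ ∸̇ ψ)

  θ₀ : Formula
  θ₀ = rel R₀ (replicate _ (var 0))

  𝟙 : Formula
  𝟙 = ¬̇ (θ₀ ∸̇ θ₀)

  2^-_ : ℕ → Formula
  2^- ℕ.zero  = 𝟙
  2^- ℕ.suc n = ½̇ (2^- n)

  dy : Dy → Formula
  dy one          = 𝟙
  dy (dneg a)     = ¬̇ dy a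
  dy (dminus a b) = dy a ∸̇ dy b
  dy (dhalf a)    = ½̇ dy a

  dist : (d : Rel) → arR d ≡ 2 → Term → Term → Formula
  dist d eq s t = rel d (subst (Vec Term) (sym eq) (s ∷ t ∷ []))

  data Ax0 : Formula → Set where
    A1 : ∀ φ ψ → Ax0 ((φ ∸̇ ψ) ∸̇ φ)
    A2 : ∀ φ ψ χ → Ax0 (((χ ∸̇ φ) ∸̇ (χ ∸̇ ψ)) ∸̇ (ψ ∸̇ φ))
    A3 : ∀ φ ψ → Ax0 ((φ ∸̇ (φ ∸̇ ψ)) ∸̇ (ψ ∸̇ (ψ ∸̇ φ)))
    A4 : ∀ φ ψ → Ax0 ((φ ∸̇ ψ) ∸̇ (¬̇ ψ ∸̇ ¬̇ φ))
    A5 : ∀ φ → Ax0 (½̇ φ ∸̇ (φ ∸̇ ½̇ φ))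
    A6 : ∀ φ → Ax0 ((φ ∸̇ ½̇ φ) ∸̇ ½̇ φ)
    A7 : ∀ x φ ψ → Ax0 ((sup x ψ ∸̇ sup x φ) ∸̇ sup x (ψ ∸̇ φ))
    A8 : ∀ x φ t → FreeFor t x φ → Ax0 ((φ [ t / x ]) ∸̇ sup x φ)
    A9 : ∀ x φ → ¬ FreeIn x φ → Ax0 (sup x φ ∸̇ φ)
    A10 : ∀ {d eq} → metric ≡ just (d , eq) → ∀ x →
          Ax0 (dist d eq (var x) (var x))
    A11 : ∀ {d eq} → metric ≡ just (d , eq) → ∀ x y →
          Ax0 (dist d eq (var x) (var y) ∸̇ dist d eq (var y) (var x))
    A12 : ∀ {d eq} → metric ≡ just (d , eq) → ∀ x y z →
          Ax0 ((dist d eq (var x) (var z) ∸̇ dist d eq (var x) (var y)) ∸̇ dist d eq (var y) (var z))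
    -- v lists the variables x̄ z ȳ (resp. x̄ w ȳ) with z (resp. w) at position i = |x̄|
    A13 : ∀ {d eq} → metric ≡ just (d , eq) →
          ∀ (f : Fun) (i : Fin (arF f)) (v : Vec ℕ (arF f)) (z w : ℕ) (q r : Dy) →
          δF f i (val q) (val r) →
          Ax0 ((dy q ∸̇ dist d eq (var z) (var w)) ∧̇
               (dist d eq (app f (map var (v [ i ]≔ z))) (app f (map var (v [ i ]≔ w))) ∸̇ dy r))
    A14 : ∀ {d eq} → metric ≡ just (d , eq) →
          ∀ (P : Rel) (i : Fin (arR P)) (v : Vec ℕ (arR P)) (z w : ℕ) (q r : Dy) →
          δR P i (val q) (val r) →
          Ax0 ((dy q ∸̇ dist d eq (var z) (var w)) ∧̇
               ((rel P (map var (v [ i ]≔ z)) ∸̇ rel P (map var (v [ i ]≔ w))) ∸̇ dy r))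

  data Axiom : Formula → Set where
    base : ∀ {χ} → Ax0 χ → Axiom χ
    gen  : ∀ {φ} x → Axiom φ → Axiom (sup x φ)

  FSet : Set₁
  FSet = Formula → Set

  _⊆_ : FSet → FSet → Set
  Γ ⊆ Δ = ∀ {φ} → Γ φ → Δ φ

  data _⊢_ (Γ : FSet) : Formula → Set where
    ax  : ∀ {φ} → Axiom φ → Γ ⊢ φ
    hyp : ∀ {φ} → Γ φ → Γ ⊢ φ
    mp  : ∀ {φ ψ} → Γ ⊢ φ → Γ ⊢ (ψ ∸̇ φ) → Γ ⊢ ψ

  Inconsistent : FSet → Set
  Inconsistent Γ = ∀ φ → Γ ⊢ φ

  Consistent : FSet → Set
  Consistent Γ = ¬ Inconsistent Γ

  E : FSet → FSet → Set
  E Γ Γ' = Γ ⊆ Γ' × Consistent Γ'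

  MaximalIn-E : FSet → FSet → Set₁
  MaximalIn-E Γ Δ = E Γ Δ × (∀ (Δ' : FSet) → E Γ Δ' → Δ ⊆ Δ' → Δ' ⊆ Δ)

-- Read a ⇒ b as b ∸ a, so that ⊢ asserts the value 0 and Δ ⊢ 𝟙 makes Δ
-- inconsistent.  A deduction theorem holds with iterated antecedents: if
-- Δ ∪ {α} ⊢ χ then Δ ⊢ α ⇒ ⋯ ⇒ α ⇒ χ (k times).  For (ii): if Δ ∪ {φ} ⊢ 𝟙
-- uses φ k times and Δ ⊢ 2^-(k+1) ⇒ φ, then Δ ⊢ 2^-(k+1) ⇒ ⋯ ⇒ 2^-(k+1) ⇒ 𝟙
-- padded to 2^k copies, and repeated halving (axioms A5, A6) refutes Δ.
-- For (iii): the Łukasiewicz prelinearity law (a ⇒ b) ∨ (b ⇒ a), where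
-- a ∨ b is (a ⇒ b) ⇒ b, combines refutations of both one-point extensions
-- into a refutation of Δ; excluded middle is used only here.
-- Conversely, if Δ' ⊇ Δ is consistent and φ ∈ Δ', then (iii) puts φ ∸ 2^-n in
-- Δ for every n, because 2^-n ∸ φ ∈ Δ would give Δ' ⊢ 2^-n, hence Δ' ⊢ 𝟙;
-- so φ ∈ Δ by (ii).
module Submission where

open import Defs
open import Level using (0ℓ)
open import Axiom.ExcludedMiddle using (ExcludedMiddle)
open import Data.Product using (_×_; _,_; proj₁; ∃-syntax)
open import Data.Empty using (⊥-elim)
open import Data.Sum using (_⊎_; inj₁; inj₂)
open import Data.Nat using (ℕ; zero; suc; _+_; _*_; _^_; _≤_; z≤n; s≤s)
open import Data.Nat.Properties using (*-suc; +-identityʳ; +-mono-≤; m^n>0)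
open import Function.Bundles using (_⇔_; mk⇔)
open import Relation.Nullary using (yes; no)
open import Relation.Binary.PropositionalEquality using (_≡_; refl; subst; sym; cong)

n≤2^n : ∀ n → n ≤ 2 ^ n
n≤2^n zero    = z≤n
n≤2^n (suc n) = subst (suc n ≤_) (cong (2 ^ n +_) (sym (+-identityʳ (2 ^ n))))
  (+-mono-≤ (m^n>0 2 n) (n≤2^n n))

module ContinuousLogic (L : Signature) where
  open Syntax L

  infixr 5 _⇒_
  infixr 6 _⇒[_]_
  infix 6 _∨_

  _⇒_ : Formula → Formula → Formula
  a ⇒ b = b ∸̇ a

  _∨_ : Formula → Formula → Formula
  a ∨ b = (a ⇒ b) ⇒ b

  _⇒[_]_ : Formula → ℕ → Formula → Formula
  a ⇒[ zero ]  c = c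
  a ⇒[ suc k ] c = a ⇒ a ⇒[ k ] c

  ⇒[]-+ : ∀ a k m c → a ⇒[ k + m ] c ≡ a ⇒[ k ] a ⇒[ m ] c
  ⇒[]-+ a zero    m c = refl
  ⇒[]-+ a (suc k) m c = cong (a ⇒_) (⇒[]-+ a k m c)

  _∪｛_｝ : FSet → Formula → FSet
  (Δ ∪｛ α ｝) χ = Δ χ ⊎ χ ≡ α

  module _ {Δ : FSet} where

    infixl 3 _▷_
    infixr 5 _⨾_

    _▷_ : ∀ {a b} → Δ ⊢ a → Δ ⊢ (a ⇒ b) → Δ ⊢ b
    _▷_ = mp

    K : ∀ a b → Δ ⊢ (a ⇒ b ⇒ a)
    K a b = ax (base (A1 a b))

    ⇒-trans : ∀ a b c → Δ ⊢ ((a ⇒ b) ⇒ (b ⇒ c) ⇒ (a ⇒ c))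
    ⇒-trans a b c = ax (base (A2 a b c))

    ∨-comm : ∀ a b → Δ ⊢ (a ∨ b ⇒ b ∨ a)
    ∨-comm a b = ax (base (A3 a b))

    contraposition⁻¹ : ∀ a b → Δ ⊢ ((¬̇ a ⇒ ¬̇ b) ⇒ (b ⇒ a))
    contraposition⁻¹ a b = ax (base (A4 a b))

    ½-bound : ∀ a → Δ ⊢ ((½̇ a ⇒ a) ⇒ ½̇ a)
    ½-bound a = ax (base (A5 a))

    ½-split : ∀ a → Δ ⊢ (½̇ a ⇒ ½̇ a ⇒ a)
    ½-split a = ax (base (A6 a))

    _⨾_ : ∀ {a b c} → Δ ⊢ (a ⇒ b) → Δ ⊢ (b ⇒ c) → Δ ⊢ (a ⇒ c)
    _⨾_ {a} {b} {c} p q = q ▷ (p ▷ ⇒-trans a b c)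

    ⇒-antimonoˡ : ∀ {a b} c → Δ ⊢ (a ⇒ b) → Δ ⊢ ((b ⇒ c) ⇒ (a ⇒ c))
    ⇒-antimonoˡ {a} {b} c p = p ▷ ⇒-trans a b c

    ⇒-refl : ∀ a → Δ ⊢ (a ⇒ a)
    ⇒-refl a = K a t ⨾ ((K a a ▷ K t (a ⇒ t)) ▷ ∨-comm a t)
      where t = a ⇒ a ⇒ a

    ⇒-eval : ∀ a b → Δ ⊢ (a ⇒ (a ⇒ b) ⇒ b)
    ⇒-eval a b = K a (b ⇒ a) ⨾ ∨-comm b a

    ⇒-exchange : ∀ a b c → Δ ⊢ ((a ⇒ b ⇒ c) ⇒ (b ⇒ a ⇒ c))
    ⇒-exchange a b c =
      ⇒-trans a (b ⇒ c) c ⨾ (⇒-eval b c ▷ ⇒-trans b ((b ⇒ c) ⇒ c) (a ⇒ c))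

    exchange : ∀ {a b c} → Δ ⊢ (a ⇒ b ⇒ c) → Δ ⊢ (b ⇒ a ⇒ c)
    exchange {a} {b} {c} p = p ▷ ⇒-exchange a b c

    ⇒-monoʳ : ∀ {a b} c → Δ ⊢ (a ⇒ b) → Δ ⊢ ((c ⇒ a) ⇒ (c ⇒ b))
    ⇒-monoʳ {a} {b} c p = p ▷ exchange (⇒-trans c a b)

    ∨-elim : ∀ {a b c} → Δ ⊢ (a ∨ b) → Δ ⊢ (a ⇒ c) → Δ ⊢ (b ⇒ c) → Δ ⊢ c
    ∨-elim {a} {b} {c} a∨b a⇒c b⇒c =
      a∨b ▷ ⇒-antimonoˡ b (⇒-antimonoˡ b a⇒c)
            ⨾ ∨-comm c b ⨾ (b⇒c ▷ ⇒-eval (b ⇒ c) c)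

    ⊢𝟙⇒inconsistent : Δ ⊢ 𝟙 → Inconsistent Δ
    ⊢𝟙⇒inconsistent ⊢𝟙 χ =
      ⇒-refl θ₀ ▷ ((⊢𝟙 ▷ K (¬̇ (θ₀ ⇒ θ₀)) (¬̇ χ)) ▷ contraposition⁻¹ χ (θ₀ ⇒ θ₀))

    ⊢2^-⇒⊢𝟙 : ∀ n → Δ ⊢ (2^- n) → Δ ⊢ 𝟙
    ⊢2^-⇒⊢𝟙 zero    p = p
    ⊢2^-⇒⊢𝟙 (suc n) p = ⊢2^-⇒⊢𝟙 n (p ▷ (p ▷ ½-split (2^- n)))

    ¬-elim : ∀ a b → Δ ⊢ (¬̇ a ⇒ a ⇒ b)
    ¬-elim a b = K (¬̇ a) (¬̇ b) ⨾ contraposition⁻¹ b a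

    ¬¬-elim : ∀ a → Δ ⊢ (¬̇ ¬̇ a ⇒ a)
    ¬¬-elim a = ⇒-refl θ₀ ▷ exchange (¬-elim (¬̇ a) (¬̇ t) ⨾ contraposition⁻¹ a t)
      where t = θ₀ ⇒ θ₀

    ¬¬-intro : ∀ a → Δ ⊢ (a ⇒ ¬̇ ¬̇ a)
    ¬¬-intro a = ¬¬-elim (¬̇ a) ▷ contraposition⁻¹ (¬̇ ¬̇ a) a

    contraposition : ∀ a b → Δ ⊢ ((a ⇒ b) ⇒ (¬̇ b ⇒ ¬̇ a))
    contraposition a b =
      ⇒-antimonoˡ b (¬¬-elim a) ⨾ ⇒-monoʳ (¬̇ ¬̇ a) (¬¬-intro b)
        ⨾ contraposition⁻¹ (¬̇ a) (¬̇ b)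

    ¬-swap : ∀ a b → Δ ⊢ ((a ⇒ ¬̇ b) ⇒ (b ⇒ ¬̇ a))
    ¬-swap a b = contraposition a (¬̇ b) ⨾ ⇒-antimonoˡ (¬̇ a) (¬¬-intro b)

    -- Semantically both sides are c ∸ max(a, b).
    ⇒-max-comm : ∀ a b c → Δ ⊢ ((a ⇒ (a ⇒ b) ⇒ c) ⇒ (b ⇒ (b ⇒ a) ⇒ c))
    ⇒-max-comm a b c =
      ⇒-monoʳ a (contraposition (a ⇒ b) c)
      ⨾ ⇒-exchange a (¬̇ c) (¬̇ (a ⇒ b))
      ⨾ ⇒-monoʳ (¬̇ c) (¬-swap a (a ⇒ b))
      ⨾ ⇒-monoʳ (¬̇ c) (⇒-antimonoˡ (¬̇ a) (contraposition⁻¹ b a))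
      ⨾ ⇒-monoʳ (¬̇ c) (∨-comm (¬̇ b) (¬̇ a))
      ⨾ ⇒-monoʳ (¬̇ c) (⇒-antimonoˡ (¬̇ b) (contraposition b a))
      ⨾ ⇒-monoʳ (¬̇ c) (¬-swap (b ⇒ a) b)
      ⨾ ⇒-exchange (¬̇ c) b (¬̇ (b ⇒ a))
      ⨾ ⇒-monoʳ b (contraposition⁻¹ c (b ⇒ a))

    merge-halves : ∀ a c → Δ ⊢ ((½̇ a ⇒ ½̇ a ⇒ c) ⇒ (a ⇒ c))
    merge-halves a c =
      ⇒-monoʳ h (⇒-antimonoˡ c (½-bound a))
      ⨾ ⇒-antimonoˡ (g ⇒ c) h∨a⇒h
      ⨾ base-change
      ⨾ (K a h ▷ ⇒-eval (a ⇒ g) (a ⇒ c))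
      where
      h = ½̇ a
      g = h ⇒ a
      h∨a⇒h : Δ ⊢ (h ∨ a ⇒ h)
      h∨a⇒h = ∨-comm h a ⨾ ((K a h ⨾ ½-bound a) ▷ ⇒-eval (a ⇒ h) h)
      base-change : Δ ⊢ (((g ⇒ a) ⇒ (g ⇒ c)) ⇒ ((a ⇒ g) ⇒ (a ⇒ c)))
      base-change = ⇒-exchange (g ⇒ a) g c ⨾ ⇒-max-comm g a c ⨾ ⇒-exchange a (a ⇒ g) c

    -- Łukasiewicz's fifth axiom, derivable from the other four (Meredith, Chang).
    prelinearity : ∀ a b → Δ ⊢ ((a ⇒ b) ∨ (b ⇒ a))
    prelinearity a b =
      ⇒-antimonoˡ (b ⇒ a) (⇒-antimonoˡ b (⇒-eval a b))
      ⨾ ⇒-monoʳ (j ⇒ b) (⇒-eval (b ⇒ a) a ⨾ ⇒-antimonoˡ a (∨-comm a b))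
      ⨾ ⇒-exchange (j ⇒ b) j a
      ⨾ ⇒-max-comm j b a
      ⨾ ⇒-monoʳ b (K b (a ⇒ b) ▷ ⇒-eval (b ⇒ j) a)
      where j = a ∨ b

    ⇒[]-monoʳ : ∀ {a b} α k → Δ ⊢ (a ⇒ b) → Δ ⊢ (α ⇒[ k ] a ⇒ α ⇒[ k ] b)
    ⇒[]-monoʳ α zero    p = p
    ⇒[]-monoʳ α (suc k) p = ⇒-monoʳ α (⇒[]-monoʳ α k p)

    ⇒[]-antimonoˡ : ∀ {a b} k c → Δ ⊢ (b ⇒ a) → Δ ⊢ (a ⇒[ k ] c ⇒ b ⇒[ k ] c)
    ⇒[]-antimonoˡ zero        c p = ⇒-refl c
    ⇒[]-antimonoˡ {a} {b} (suc k) c p =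
      ⇒-antimonoˡ (a ⇒[ k ] c) p ⨾ ⇒-monoʳ b (⇒[]-antimonoˡ k c p)

    ⇒[]-exchange : ∀ α k a b → Δ ⊢ (α ⇒[ k ] (a ⇒ b) ⇒ a ⇒ α ⇒[ k ] b)
    ⇒[]-exchange α zero    a b = ⇒-refl (a ⇒ b)
    ⇒[]-exchange α (suc k) a b =
      ⇒-monoʳ α (⇒[]-exchange α k a b) ⨾ ⇒-exchange α a (α ⇒[ k ] b)

    ⇒[]-weaken : ∀ α k c → Δ ⊢ (c ⇒ α ⇒[ k ] c)
    ⇒[]-weaken α zero    c = ⇒-refl c
    ⇒[]-weaken α (suc k) c = ⇒[]-weaken α k c ⨾ K (α ⇒[ k ] c) α

    ⇒[]-mono-≤ : ∀ α {k n} c → k ≤ n → Δ ⊢ (α ⇒[ k ] c ⇒ α ⇒[ n ] c)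
    ⇒[]-mono-≤ α {n = n} c z≤n = ⇒[]-weaken α n c
    ⇒[]-mono-≤ α c (s≤s k≤n) = ⇒-monoʳ α (⇒[]-mono-≤ α c k≤n)

    ⇒[]-merge-halves : ∀ a j c → Δ ⊢ (½̇ a ⇒[ 2 * j ] c ⇒ a ⇒[ j ] c)
    ⇒[]-merge-halves a zero    c = ⇒-refl c
    ⇒[]-merge-halves a (suc j) c =
      subst (λ n → Δ ⊢ (½̇ a ⇒[ n ] c ⇒ a ⇒[ suc j ] c)) (sym (*-suc 2 j))
        (merge-halves a (½̇ a ⇒[ 2 * j ] c) ⨾ ⇒-monoʳ a (⇒[]-merge-halves a j c))

    -- The antecedents only sum to ½; merging halves reduces to m = 0, where ½-bound applies.
    halves-refute : ∀ m → Δ ⊢ (2^- suc m ⇒[ 2 ^ m ] 𝟙) → Δ ⊢ 𝟙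
    halves-refute zero    p = (p ▷ ½-bound 𝟙) ▷ p
    halves-refute (suc m) p = halves-refute m (p ▷ ⇒[]-merge-halves (2^- suc m) (2 ^ m) 𝟙)

    ∨-elim-⇒[] : ∀ {u v c} k m → Δ ⊢ (u ∨ v) →
                 Δ ⊢ (u ⇒[ k ] c) → Δ ⊢ (v ⇒[ m ] c) → Δ ⊢ c
    ∨-elim-⇒[] zero m u∨v p q = p
    ∨-elim-⇒[] {u} {v} {c} (suc k) m u∨v p q =
      ∨-elim-⇒[] k m u∨v (discharge-v m p (q ▷ ⇒[]-monoʳ v m (⇒[]-weaken u k c))) q
      where
      discharge-v : ∀ m {d} → Δ ⊢ (u ⇒ d) → Δ ⊢ (v ⇒[ m ] d) → Δ ⊢ d
      discharge-v zero        u⇒d q = q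
      discharge-v (suc m) {d} u⇒d q =
        discharge-v m u⇒d (∨-elim u∨v (u⇒d ⨾ ⇒[]-weaken v m d) q)

  deduction : ∀ {Δ α χ} → (Δ ∪｛ α ｝) ⊢ χ → ∃[ k ] Δ ⊢ (α ⇒[ k ] χ)
  deduction (ax a)                  = 0 , ax a
  deduction (hyp (inj₁ χ∈Δ))        = 0 , hyp χ∈Δ
  deduction {α = α} (hyp (inj₂ refl)) = 1 , ⇒-refl α
  deduction {Δ} {α} (mp {φ} {ψ} p q) with deduction p | deduction q
  ... | k , p' | m , q' = k + m , subst (Δ ⊢_) (sym (⇒[]-+ α k m ψ))
    (p' ▷ ⇒[]-monoʳ α k (q' ▷ ⇒[]-exchange α m φ ψ))

  module _ {Γ Δ : FSet} where

    MaximalIn-E⇒absorbs : MaximalIn-E Γ Δ → ∀ {α} → Consistent (Δ ∪｛ α ｝) → Δ α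
    MaximalIn-E⇒absorbs ((Γ⊆Δ , _) , maximal) {α} consistent =
      maximal (Δ ∪｛ α ｝) ((λ γ → inj₁ (Γ⊆Δ γ)) , consistent) inj₁ (inj₂ refl)

    MaximalIn-E⇒approx-closed : MaximalIn-E Γ Δ →
      ∀ φ → (∀ n → Δ ⊢ (φ ∸̇ 2^- n)) → Δ φ
    MaximalIn-E⇒approx-closed max@((_ , consistent) , _) φ approx =
      MaximalIn-E⇒absorbs max λ inconsistent →
        let k , φ⇒𝟙 = deduction (inconsistent 𝟙) in
        consistent (⊢𝟙⇒inconsistent (halves-refute k
          (φ⇒𝟙 ▷ ⇒[]-antimonoˡ k 𝟙 (approx (suc k))
               ▷ ⇒[]-mono-≤ (2^- suc k) 𝟙 (n≤2^n k))))

    MaximalIn-E⇒linear : ExcludedMiddle 0ℓ → MaximalIn-E Γ Δ →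
      ∀ φ ψ → Δ (φ ∸̇ ψ) ⊎ Δ (ψ ∸̇ φ)
    MaximalIn-E⇒linear em max@((_ , consistent) , _) φ ψ
      with em {Inconsistent (Δ ∪｛ φ ∸̇ ψ ｝)}
    ... | no  consistent₁ = inj₁ (MaximalIn-E⇒absorbs max consistent₁)
    ... | yes inconsistent₁ = inj₂ (MaximalIn-E⇒absorbs max λ inconsistent₂ →
          let k , p = deduction (inconsistent₁ 𝟙)
              m , q = deduction (inconsistent₂ 𝟙)
          in consistent (⊢𝟙⇒inconsistent (∨-elim-⇒[] k m (prelinearity ψ φ) p q)))

    approx-closed∧linear⇒MaximalIn-E : E Γ Δ →
      (∀ φ → (∀ n → Δ ⊢ (φ ∸̇ 2^- n)) → Δ φ) →
      (∀ φ ψ → Δ (φ ∸̇ ψ) ⊎ Δ (ψ ∸̇ φ)) → MaximalIn-E Γ Δ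
    approx-closed∧linear⇒MaximalIn-E eΔ closed linear =
      eΔ , λ Δ' (_ , consistent') Δ⊆Δ' {φ} φ∈Δ' → closed φ λ n →
        approx consistent' Δ⊆Δ' φ∈Δ' n (linear φ (2^- n))
      where
      approx : ∀ {Δ' φ} → Consistent Δ' → Δ ⊆ Δ' → Δ' φ → ∀ n →
               Δ (φ ∸̇ 2^- n) ⊎ Δ (2^- n ∸̇ φ) → Δ ⊢ (φ ∸̇ 2^- n)
      approx _           _    _    n (inj₁ φ∸2^-n) = hyp φ∸2^-n
      approx consistent' Δ⊆Δ' φ∈Δ' n (inj₂ 2^-n∸φ) = ⊥-elim
        (consistent' (⊢𝟙⇒inconsistent (⊢2^-⇒⊢𝟙 n (hyp φ∈Δ' ▷ hyp (Δ⊆Δ' 2^-n∸φ)))))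

-- Consistency of Γ only ensures E(Γ) ≠ ∅; the characterisation holds without it.
lemma8p6 : ExcludedMiddle 0ℓ → (L : Signature) → let open Syntax L in
    (Γ : FSet) → Consistent Γ → (Δ : FSet) →
    MaximalIn-E Γ Δ ⇔
      ( E Γ Δ
      × (∀ (φ : Formula) → (∀ (n : ℕ) → Δ ⊢ (φ ∸̇ 2^- n)) → Δ φ)
      × (∀ (φ ψ : Formula) → Δ (φ ∸̇ ψ) ⊎ Δ (ψ ∸̇ φ)) )
lemma8p6 em L Γ _ Δ = mk⇔
  (λ max → proj₁ max , MaximalIn-E⇒approx-closed max , MaximalIn-E⇒linear em max)
  (λ (eΔ , closed , linear) → approx-closed∧linear⇒MaximalIn-E eΔ closed linear)
  where open ContinuousLogic L
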